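{- Let $G=(V,E)$ be a graph of neighborhood diversity $w$ with a vertex partition $V=W_1\,\dot\cup\,\cdots\,\dot\cup\, W_w$ into twin classes. Let $W_i$ be a false twin class containing two distinct vertices $u,v\in W_i$. Then, for every $k$, $G-v$ has a $k$-Grundy coloring if and only if $G$ has a $k$-Grundy coloring.
   Context: A $k$-Grundy coloring of a graph $(V,E)$ is a partition of $V$ into $k$ non-empty independent sets $V_1,\ldots,V_k$ such that for each $i\in[k-1]$ every vertex of $\bigcup_{j>i}V_j$ has a neighbor in $V_i$. Two vertices $u,v$ are twins if $N(u)\setminus\{v\}=N(v)\setminus\{u\}$; true twins if adjacent, false twins if non-adjacent. A twin class is a maximal set of pairwise twins; it is either a clique (true twin class) or an independent set (false twin class). $G$ has neighborhood diversity $w$ if $V$ can be partitioned into at most $w$ twin classes. -}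

module Defs where

open import Data.Nat using (ℕ)
open import Data.Fin using (Fin; _<_)
open import Data.Product using (Σ; ∃; _×_; _,_; proj₁)
open import Relation.Nullary using (¬_)
open import Relation.Binary using (Decidable)
open import Relation.Binary.PropositionalEquality using (_≡_; _≢_)
open import Function.Bundles using (_⇔_)

record Graph (V : Set) : Set₁ where
  field
    Adj    : V → V → Set
    sym    : ∀ {x y} → Adj x y → Adj y x
    irrefl : ∀ {x} → ¬ Adj x x
    adj?   : Decidable Adj
open Graph public

_─_ : ∀ {n} → Graph (Fin n) → (v : Fin n) → Graph (Σ (Fin n) (λ x → x ≢ v))
G ─ v = record
  { Adj    = λ x y → Adj G (proj₁ x) (proj₁ y)
  ; sym    = sym G
  ; irrefl = irrefl G
  ; adj?   = λ x y → adj? G (proj₁ x) (proj₁ y)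
  }

record GrundyColoring {V : Set} (G : Graph V) (k : ℕ) : Set where
  field
    col      : V → Fin k
    nonempty : ∀ (i : Fin k) → ∃ λ x → col x ≡ i
    indep    : ∀ {x y} → Adj G x y → col x ≢ col y
    grundy   : ∀ x (i : Fin k) → i < col x → ∃ λ y → Adj G x y × col y ≡ i

Twins : ∀ {n} → Graph (Fin n) → Fin n → Fin n → Set
Twins G u v = ∀ x → x ≢ u → x ≢ v → (Adj G u x ⇔ Adj G v x)

record IsTwinPartition {n w : ℕ} (G : Graph (Fin n)) (W : Fin n → Fin w) : Set where
  field
    nonempty : ∀ (i : Fin w) → ∃ λ x → W x ≡ i
    twins    : ∀ x y → W x ≡ W y → Twins G x y
    maximal  : ∀ x (i : Fin w) → W x ≢ i →
               ¬ (∀ y → W y ≡ i → Twins G x y)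

FalseTwinClass : ∀ {n w} → Graph (Fin n) → (Fin n → Fin w) → Fin w → Set
FalseTwinClass G W i = ∀ x y → W x ≡ i → W y ≡ i → ¬ Adj G x y

module Submission where

-- Proof idea.  Two facts about vertices with the same open neighbourhood
-- N(x) = N(y) (the relation SameNbh below) drive the argument:
--
--   * In any Grundy coloring, vertices with the same neighbourhood get the
--     same colour: if col x < col y, the Grundy condition gives y a
--     neighbour of colour col x, which is also a neighbour of x.
--   * If u ≢ v have the same neighbourhood, the map `retract` sending v to u and
--     fixing every other vertex is a "retraction" of G onto G - v that
--     preserves neighbourhoods.  Composing a coloring of G - v with it gives
--     a coloring of G (v copies the colour of u); restricting a coloring of
--     G to G - v stays a coloring because every lost witness v can be
--     replaced by u, which has the same colour.
--
-- The theorem follows because two vertices of a false twin class are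
-- non-adjacent twins, hence have exactly the same neighbourhood.

open import Defs
open import Data.Nat using (ℕ)
open import Data.Fin using (Fin; _<_; _≟_)
open import Data.Fin.Properties using (<-cmp)
open import Data.Product using (Σ; _×_; _,_; proj₁)
open import Data.Empty using (⊥-elim)
open import Relation.Nullary using (¬_; yes; no)
open import Relation.Binary using (tri<; tri≈; tri>)
open import Relation.Binary.PropositionalEquality using (_≡_; _≢_; refl; trans)
  renaming (sym to ≡-sym)
open import Function.Bundles using (_⇔_; mk⇔; Equivalence)
import Function.Properties.Equivalence as ⇔

open Equivalence using (to; from)

SameNbh : ∀ {V : Set} → Graph V → V → V → Set
SameNbh G x y = ∀ z → Adj G x z ⇔ Adj G y z

module _ {V : Set} {G : Graph V} {k : ℕ} (C : GrundyColoring G k) where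
  open GrundyColoring C

  -- A vertex cannot get a smaller colour than a vertex with the same
  -- neighbourhood: the Grundy witness of the larger one would be a
  -- neighbour of the smaller one sharing its colour.
  sameNbh-¬< : ∀ {x y} → SameNbh G x y → ¬ (col x < col y)
  sameNbh-¬< {x} {y} x∼y lt with grundy y (col x) lt
  ... | z , yz , colz≡colx = indep (from (x∼y z) yz) (≡-sym colz≡colx)

  sameNbh⇒sameColour : ∀ {x y} → SameNbh G x y → col x ≡ col y
  sameNbh⇒sameColour {x} {y} x∼y with <-cmp (col x) (col y)
  ... | tri< lt _ _ = ⊥-elim (sameNbh-¬< x∼y lt)
  ... | tri≈ _ eq _ = eq
  ... | tri> _ _ gt = ⊥-elim (sameNbh-¬< (λ z → ⇔.sym (x∼y z)) gt)

-- Non-adjacent twins (in the sense of Defs, where u and v themselves are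
-- excluded from the comparison) have literally the same neighbourhood.
falseTwins⇒sameNbh : ∀ {n} (G : Graph (Fin n)) {u v : Fin n} →
  ¬ Adj G u v → Twins G u v → SameNbh G u v
falseTwins⇒sameNbh G {u} {v} ¬uv tw z = mk⇔ u→v v→u
  where
  u→v : Adj G u z → Adj G v z
  u→v a = to (tw z (λ { refl → irrefl G a }) (λ { refl → ¬uv a })) a

  v→u : Adj G v z → Adj G u z
  v→u a = from (tw z (λ { refl → ¬uv (Graph.sym G a) }) (λ { refl → irrefl G a })) a

module DeleteTwin {n} (G : Graph (Fin n)) {u v : Fin n}
                  (u≢v : u ≢ v) (u∼v : SameNbh G u v) (k : ℕ) where

  H : Graph (Σ (Fin n) (λ x → x ≢ v))
  H = G ─ v

  retract : Fin n → Σ (Fin n) (λ x → x ≢ v)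
  retract x with x ≟ v
  ... | yes _  = u , u≢v
  ... | no x≢v = x , x≢v

  retract-sameNbh : ∀ x → SameNbh G (proj₁ (retract x)) x
  retract-sameNbh x with x ≟ v
  ... | yes refl = u∼v
  ... | no _     = λ _ → ⇔.refl

  retract-adj : ∀ {x y} → Adj G x y → Adj G x (proj₁ (retract y))
  retract-adj {x} {y} xy =
    Graph.sym G (from (retract-sameNbh y x) (Graph.sym G xy))

  extend : GrundyColoring H k → GrundyColoring G k
  extend C = record
    { col      = λ x → col (retract x)
    ; nonempty = nonempty′
    ; indep    = λ xy → indep (from (retract-sameNbh _ _) (retract-adj xy))
    ; grundy   = grundy′
    }
    where
    open GrundyColoring C

    retract-col : ∀ y → col (retract (proj₁ y)) ≡ col y
    retract-col y = sameNbh⇒sameColour C (λ z → retract-sameNbh (proj₁ y) (proj₁ z))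

    nonempty′ : ∀ j → Σ (Fin n) λ x → col (retract x) ≡ j
    nonempty′ j with nonempty j
    ... | y , coly≡j = proj₁ y , trans (retract-col y) coly≡j

    grundy′ : ∀ x j → j < col (retract x) →
              Σ (Fin n) λ y → Adj G x y × col (retract y) ≡ j
    grundy′ x j lt with grundy (retract x) j lt
    ... | y , xy , coly≡j =
      proj₁ y , to (retract-sameNbh x (proj₁ y)) xy , trans (retract-col y) coly≡j

  -- A coloring of G restricts to G - v; a witness v is replaced by u.
  restrict : GrundyColoring G k → GrundyColoring H k
  restrict C = record
    { col      = λ x → col (proj₁ x)
    ; nonempty = nonempty′
    ; indep    = indep
    ; grundy   = grundy′
    }
    where
    open GrundyColoring C

    retract-col : ∀ x → col (proj₁ (retract x)) ≡ col x
    retract-col x = sameNbh⇒sameColour C (retract-sameNbh x)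

    nonempty′ : ∀ j → Σ (Σ (Fin n) (λ x → x ≢ v)) λ y → col (proj₁ y) ≡ j
    nonempty′ j with nonempty j
    ... | x , colx≡j = retract x , trans (retract-col x) colx≡j

    grundy′ : ∀ x j → j < col (proj₁ x) →
              Σ (Σ (Fin n) (λ y → y ≢ v)) λ y → Adj H x y × col (proj₁ y) ≡ j
    grundy′ (x , _) j lt with grundy x j lt
    ... | y , xy , coly≡j = retract y , retract-adj xy , trans (retract-col y) coly≡j

  deleteTwin : GrundyColoring H k ⇔ GrundyColoring G k
  deleteTwin = mk⇔ extend restrict

lemma6p1 : ∀ {n w : ℕ} (G : Graph (Fin n)) (W : Fin n → Fin w) →
    IsTwinPartition G W →
    ∀ (i : Fin w) → FalseTwinClass G W i →
    ∀ (u v : Fin n) → W u ≡ i → W v ≡ i → u ≢ v →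
    ∀ (k : ℕ) → (GrundyColoring (G ─ v) k ⇔ GrundyColoring G k)
lemma6p1 G W TP i FT u v Wu≡i Wv≡i u≢v k = DeleteTwin.deleteTwin G u≢v u∼v k
  where
  u∼v : SameNbh G u v
  u∼v = falseTwins⇒sameNbh G (FT u v Wu≡i Wv≡i)
          (IsTwinPartition.twins TP u v (trans Wu≡i (≡-sym Wv≡i)))
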